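{- Let $n\ge 1$ and $1\le r\le n$ be integers. Every deterministic online algorithm for $r$-uniform Online Min-Sum Set Cover on a universe of $n$ elements has competitive ratio (against the static optimum) at least $(r+1)\left(1-\frac{r}{n+1}\right)$.
   Context: Let $U$ be a set of $n$ elements. A permutation $\pi$ of $U$ assigns each element $e$ a position $\pi[e]\in\{1,\dots,n\}$. For nonempty $S\subseteq U$, the access (cover) cost is $\pi(S)=\min_{e\in S}\pi[e]$. The Kendall tau distance $d_{KT}(\pi,\sigma)$ is the number of unordered pairs $\{a,b\}\subseteq U$ ordered differently by $\pi$ and $\sigma$. In $r$-uniform Online Min-Sum Set Cover, an initial permutation $\pi_0$ is given and request sets $S_1,\dots,S_m\subseteq U$ with $|S_t|=r$ arrive one by one. When $S_t$ arrives, the algorithm, holding permutation $\pi_{t-1}$, pays access cost $\pi_{t-1}(S_t)$ and then chooses a new permutation $\pi_t$ (depending only on $S_1,\dots,S_t$ and $\pi_0$), paying moving cost $d_{KT}(\pi_{t-1},\pi_t)$. The algorithm's cost is the total access plus moving cost. The static optimum is $\mathrm{OPT}=\min_{\pi}\sum_{t=1}^m\pi(S_t)$ over all permutations $\pi$ of $U$. An online algorithm is $c$-competitive if there is a constant $\alpha$ (independent of the request sequence, possibly depending on $n,r$) such that its cost is at most $c\cdot\mathrm{OPT}+\alpha$ for every initial permutation and request sequence; its competitive ratio is the infimum of such $c$. -}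

module Defs where

open import Data.Nat using (ℕ; zero; suc; _+_; _⊓_)
open import Data.Bool using (Bool; true; false; if_then_else_; _xor_)
open import Data.Fin using (Fin; toℕ; _<?_)
open import Data.Fin.Permutation using (Permutation′; _⟨$⟩ʳ_)
open import Data.Fin.Subset using (Subset)
open import Data.Fin.Subset.Properties using (_∈?_)
open import Data.List using (List; []; _∷_; _++_; [_]; foldr; map; allFin)
open import Data.Nat.ListAction using (sum)
open import Data.Product using (Σ; _×_)
open import Data.Nat using (_≤_)
open import Relation.Nullary using (does)
open import Relation.Binary.PropositionalEquality using (_≡_)

pos : ∀ {n} → Permutation′ n → Fin n → ℕ
pos π e = suc (toℕ (π ⟨$⟩ʳ e))

-- Access (cover) cost π(S) = min_{e ∈ S} π[e]  (S is nonempty in all uses;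
-- the fold is seeded with n, which is ≥ every position, so it is the true minimum).
access : ∀ {n} → Permutation′ n → Subset n → ℕ
access {n} π S =
  foldr (λ e acc → if does (e ∈? S) then pos π e ⊓ acc else acc) n (allFin n)

discordant : ∀ {n} → Permutation′ n → Permutation′ n → Fin n → Fin n → ℕ
discordant π σ a b =
  if does (a <? b)
  then (if does ((π ⟨$⟩ʳ a) <? (π ⟨$⟩ʳ b)) xor does ((σ ⟨$⟩ʳ a) <? (σ ⟨$⟩ʳ b)) then 1 else 0)
  else 0

dKT : ∀ {n} → Permutation′ n → Permutation′ n → ℕ
dKT {n} π σ = sum (map (λ a → sum (map (λ b → discordant π σ a b) (allFin n))) (allFin n))

-- A deterministic online algorithm: given the initial permutation π₀ and the
-- requests S₁,…,S_t seen so far (chronological order, t ≥ 1), it outputs π_t.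
OnlineAlg : ℕ → Set
OnlineAlg n = Permutation′ n → List (Subset n) → Permutation′ n

run : ∀ {n} → OnlineAlg n → Permutation′ n → Permutation′ n → List (Subset n) → List (Subset n) → ℕ
run A π₀ cur past [] = 0
run A π₀ cur past (S ∷ fut) =
  access cur S + dKT cur (A π₀ (past ++ [ S ])) + run A π₀ (A π₀ (past ++ [ S ])) (past ++ [ S ]) fut

algCost : ∀ {n} → OnlineAlg n → Permutation′ n → List (Subset n) → ℕ
algCost A π₀ seq = run A π₀ π₀ [] seq

staticCost : ∀ {n} → Permutation′ n → List (Subset n) → ℕ
staticCost π seq = sum (map (access π) seq)

IsOPT : ∀ {n} → List (Subset n) → ℕ → Set
IsOPT {n} seq o = Σ (Permutation′ n) (λ σ → staticCost σ seq ≡ o) × ((σ : Permutation′ n) → o ≤ staticCost σ seq)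

module Submission where

-- The adversary always requests the r elements in the last r positions of the algorithm's current
-- permutation, so each request costs the algorithm at least n + 1 − r.  On the other hand any m
-- requests of size r admit a static order of total cost at most m(n + 1)/(r + 1): fill the positions
-- greedily, each time with the free element lying in the most requests not yet covered; when j
-- positions are free every uncovered request has r free elements, so that element covers at least
-- an r/j fraction of them.  Taking m large enough then absorbs the additive constant α.

module LowerBound where
  open import Defs
  import Algebra.Properties.Semiring.Sum as FinSum
  open import Data.Bool using (Bool; true; false; if_then_else_; T)
  open import Data.Empty using (⊥-elim)
  open import Data.Fin using (Fin; zero; suc; toℕ; fromℕ<; punchIn)
  open import Data.Fin.Permutation
    using (Permutation′; _⟨$⟩ʳ_; _⟨$⟩ˡ_; _≈_; inverseʳ; transpose; _∘ₚ_; id; insert; remove; insert-punchIn; insert-remove)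
  open import Data.Fin.Properties using (_≟_; toℕ-fromℕ<; toℕ-injective; toℕ<n)
  open import Data.Fin.Subset using (Subset; ∣_∣; _∈_; _∉_)
  open import Data.Fin.Subset.Properties using (_∈?_)
  import Data.Integer as ℤ
  open import Data.Integer using (+_; -[1+_])
  import Data.Integer.Properties as ℤ
  open import Data.List using (List; []; _∷_; _++_; [_]; length; map; filter; foldr; allFin; cartesianProductWith)
  open import Data.List.Extrema.Nat using (argmin; argmax; argmax-all; f[argmin]≤f[xs]; f[xs]≤f[argmax])
  open import Data.List.Membership.Propositional using () renaming (_∈_ to _∈ₗ_)
  open import Data.List.Membership.Propositional.Properties using (∈-allFin; ∈-filter⁺; ∈-cartesianProductWith⁺)
  open import Data.List.Relation.Unary.All as All using (All; []; _∷_)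
  open import Data.List.Relation.Unary.All.Properties using (all-filter; filter⁺)
  open import Data.List.Relation.Unary.Any using (here; there)
  open import Data.Nat hiding (_≟_; _/_)
  open import Data.Nat.ListAction using (sum)
  open import Data.Nat.Properties hiding (_≟_)
  open import Data.Nat.Solver using (module +-*-Solver)
  open import Data.Product using (∃; _×_; _,_; proj₁; proj₂)
  open import Data.Rational using (ℚ; mkℚ; _/_; ↥_; ↧ₙ_; toℚᵘ)
  import Data.Rational as ℚ
  open import Data.Rational.Properties
    using (toℚᵘ-mono-<; toℚᵘ-cancel-<; toℚᵘ-fromℚᵘ; toℚᵘ-homo-+; toℚᵘ-homo-*)
  open import Data.Rational.Unnormalised using (mkℚᵘ; *<*)
  import Data.Rational.Unnormalised as ℚᵘ
  import Data.Rational.Unnormalised.Properties as ℚᵘ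
  open import Data.Unit using (tt)
  open import Data.Vec using ([]; _∷_; lookup; tabulate)
  open import Data.Vec.Properties using (lookup∘tabulate; []=⇒lookup)
  open import Function using (_∘_; _⇔_; mk⇔; Injection)
  open import Function.Properties.Inverse using (↔⇒↣)
  open import Level using (0ℓ)
  open import Relation.Binary.PropositionalEquality hiding ([_])
  open import Relation.Nullary using (Dec; does; yes; no; ¬?)
  open import Relation.Nullary.Decidable using (dec-true; dec-false; does-⇔)
  open import Relation.Unary using (Pred; Decidable)

  open FinSum +-*-semiring using (sum-syntax; sum-replicate-zero; sum-cong-≗; ∑-distrib-+; sum-permute; *-distribˡ-sum)
  open +-*-Solver using (solve; _:+_; _:*_; _:=_; con)

  𝟙 : Bool → ℕ
  𝟙 true  = 1
  𝟙 false = 0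

  𝟙*≤ : ∀ b m → 𝟙 b * m ≤ m
  𝟙*≤ true  m = ≤-reflexive (+-identityʳ m)
  𝟙*≤ false m = z≤n

  ∑-mono-≤ : ∀ {n} {f g : Fin n → ℕ} → (∀ x → f x ≤ g x) → ∑[ x < n ] f x ≤ ∑[ x < n ] g x
  ∑-mono-≤ {zero}  f≤g = z≤n
  ∑-mono-≤ {suc n} f≤g = +-mono-≤ (f≤g zero) (∑-mono-≤ (f≤g ∘ suc))

  sum-map-const : ∀ {A : Set} (f : A → ℕ) {r} (xs : List A) → All (λ x → f x ≡ r) xs →
                  sum (map f xs) ≡ length xs * r
  sum-map-const f []       []         = refl
  sum-map-const f (x ∷ xs) (fx≡r ∷ p) = cong₂ _+_ fx≡r (sum-map-const f xs p)

  count-≤ : ∀ n k → ∑[ i < n ] 𝟙 (does (k ≤? toℕ i)) ≡ n ∸ k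
  count-≤ zero    k       = sym (0∸n≡0 k)
  count-≤ (suc n) zero    = cong suc (count-≤ n zero)
  count-≤ (suc n) (suc k) = begin
    ∑[ i < n ] 𝟙 (does (suc k ≤? suc (toℕ i)))
      ≡⟨ sum-cong-≗ {n} (λ i → cong 𝟙 (does-⇔ (mk⇔ s≤s⁻¹ s≤s) (suc k ≤? suc (toℕ i)) (k ≤? toℕ i))) ⟩
    ∑[ i < n ] 𝟙 (does (k ≤? toℕ i))
      ≡⟨ count-≤ n k ⟩
    n ∸ k ∎
    where open ≡-Reasoning

  χ : ∀ {n} → Subset n → Fin n → ℕ
  χ S x = 𝟙 (does (x ∈? S))

  χ-∉ : ∀ {n} {S : Subset n} {x} → x ∉ S → χ S x ≡ 0
  χ-∉ {S = S} {x} x∉S = cong 𝟙 (dec-false (x ∈? S) x∉S)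

  ∣S∣≡∑χ : ∀ {n} (S : Subset n) → ∣ S ∣ ≡ ∑[ x < n ] χ S x
  ∣S∣≡∑χ []          = refl
  ∣S∣≡∑χ (true ∷ S)  = cong suc (∣S∣≡∑χ S)
  ∣S∣≡∑χ (false ∷ S) = ∣S∣≡∑χ S

  -- 0-based position: Defs.pos σ x is suc (index σ x).
  index : ∀ {n} → Permutation′ n → Fin n → ℕ
  index σ x = toℕ (σ ⟨$⟩ʳ x)

  inTail : ∀ {n} → ℕ → Permutation′ n → Fin n → ℕ
  inTail k σ x = 𝟙 (does (k ≤? index σ x))

  tail-size : ∀ {n} k (σ : Permutation′ n) → ∑[ x < n ] inTail k σ x ≡ n ∸ k
  tail-size {n} k σ = trans (sym (sum-permute (λ i → 𝟙 (does (k ≤? toℕ i))) σ)) (count-≤ n k)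

  tailCount : ∀ {n} → ℕ → Permutation′ n → Subset n → ℕ
  tailCount {n} k σ S = ∑[ x < n ] (χ S x * inTail k σ x)

  tailCount≤ : ∀ {n} k (σ : Permutation′ n) S → tailCount k σ S ≤ n ∸ k
  tailCount≤ {n} k σ S = begin
    ∑[ x < n ] (χ S x * inTail k σ x) ≤⟨ ∑-mono-≤ (λ x → 𝟙*≤ (does (x ∈? S)) (inTail k σ x)) ⟩
    ∑[ x < n ] inTail k σ x           ≡⟨ tail-size k σ ⟩
    n ∸ k                             ∎
    where open ≤-Reasoning

  weight : ∀ {n} → List (Subset n) → Fin n → ℕ
  weight seq x = sum (map (λ S → χ S x) seq)

  double-counting : ∀ {n} (t : Fin n → ℕ) seq →
                  ∑[ x < n ] (weight seq x * t x) ≡ sum (map (λ S → ∑[ x < n ] (χ S x * t x)) seq)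
  double-counting {n} t []      = sum-replicate-zero n
  double-counting {n} t (S ∷ L) = begin
    ∑[ x < n ] ((χ S x + weight L x) * t x)
      ≡⟨ sum-cong-≗ {n} (λ x → *-distribʳ-+ (t x) (χ S x) (weight L x)) ⟩
    ∑[ x < n ] (χ S x * t x + weight L x * t x)
      ≡⟨ ∑-distrib-+ (λ x → χ S x * t x) (λ x → weight L x * t x) ⟩
    ∑[ x < n ] (χ S x * t x) + ∑[ x < n ] (weight L x * t x)
      ≡⟨ cong (_+_ (∑[ x < n ] (χ S x * t x))) (double-counting t L) ⟩
    ∑[ x < n ] (χ S x * t x) + sum (map (λ S → ∑[ x < n ] (χ S x * t x)) L) ∎
    where open ≡-Reasoning

  -- Greedy upper bound on OPT

  AgreeBelow : ∀ {n} → ℕ → Permutation′ n → Permutation′ n → Set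
  AgreeBelow k σ τ = ∀ x → index σ x < k → τ ⟨$⟩ʳ x ≡ σ ⟨$⟩ʳ x

  transpose-ˡ : ∀ {n} (i j : Fin n) → transpose i j ⟨$⟩ʳ i ≡ j
  transpose-ˡ i j rewrite dec-true (i ≟ i) refl = refl

  transpose-ʳ : ∀ {n} (i j : Fin n) → transpose i j ⟨$⟩ʳ j ≡ i
  transpose-ʳ i j with j ≟ i
  ... | yes refl = refl
  ... | no  _ rewrite dec-true (j ≟ j) refl = refl

  transpose-other : ∀ {n} {i j k : Fin n} → k ≢ i → k ≢ j → transpose i j ⟨$⟩ʳ k ≡ k
  transpose-other {i = i} {j} {k} k≢i k≢j rewrite dec-false (k ≟ i) k≢i | dec-false (k ≟ j) k≢j = refl

  record Moved {n} (σ : Permutation′ n) (k : ℕ) (e : Fin n) : Set where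
    field
      σ′     : Permutation′ n
      agree  : AgreeBelow k σ σ′
      placed : index σ′ e ≡ k
      shift  : ∀ x → x ≢ e → inTail (suc k) σ′ x ≡ inTail k σ x

  moveTo : ∀ {n} (σ : Permutation′ n) k e → k ≤ index σ e → Moved σ k e
  moveTo {n} σ k e k≤σe = record { σ′ = σ′ ; agree = agree ; placed = placed ; shift = shift }
    where
    p = σ ⟨$⟩ʳ e
    k<n : k < n
    k<n = ≤-<-trans k≤σe (toℕ<n p)
    k′ = fromℕ< k<n
    toℕk′ : toℕ k′ ≡ k
    toℕk′ = toℕ-fromℕ< k<n
    σ′ = σ ∘ₚ transpose k′ p
    σ-injective : ∀ {x y} → σ ⟨$⟩ʳ x ≡ σ ⟨$⟩ʳ y → x ≡ y
    σ-injective = Injection.injective (↔⇒↣ σ)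

    agree : AgreeBelow k σ σ′
    agree x σx<k = transpose-other
      (λ σx≡k′ → <⇒≢ σx<k (trans (cong toℕ σx≡k′) toℕk′))
      (λ σx≡p → <⇒≱ σx<k (subst (k ≤_) (cong toℕ (sym σx≡p)) k≤σe))

    placed : index σ′ e ≡ k
    placed = trans (cong toℕ (transpose-ʳ k′ p)) toℕk′

    shift : ∀ x → x ≢ e → inTail (suc k) σ′ x ≡ inTail k σ x
    shift x x≢e = cong 𝟙 (does-⇔ (tail-⇔ (σ ⟨$⟩ʳ x ≟ k′)) (suc k ≤? index σ′ x) (k ≤? index σ x))
      where
      tail-⇔ : Dec (σ ⟨$⟩ʳ x ≡ k′) → suc k ≤ index σ′ x ⇔ k ≤ index σ x
      tail-⇔ (yes σx≡k′) = mk⇔ (λ _ → k≤σx) (λ _ → k<σ′x)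
        where
        k≤σx : k ≤ index σ x
        k≤σx = ≤-reflexive (trans (sym toℕk′) (cong toℕ (sym σx≡k′)))
        k<p : k < toℕ p
        k<p = ≤∧≢⇒< k≤σe (λ k≡p → x≢e (σ-injective (trans σx≡k′ (toℕ-injective (trans toℕk′ k≡p)))))
        σ′x≡p : σ′ ⟨$⟩ʳ x ≡ p
        σ′x≡p = trans (cong (transpose k′ p ⟨$⟩ʳ_) σx≡k′) (transpose-ˡ k′ p)
        k<σ′x : k < index σ′ x
        k<σ′x = subst (λ y → k < toℕ y) (sym σ′x≡p) k<p
      tail-⇔ (no σx≢k′) = subst (λ y → suc k ≤ toℕ y ⇔ k ≤ index σ x)
        (sym (transpose-other σx≢k′ (x≢e ∘ σ-injective)))
        (mk⇔ <⇒≤ (λ k≤σx → ≤∧≢⇒< k≤σx k≢σx))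
        where
        k≢σx : k ≢ index σ x
        k≢σx k≡σx = σx≢k′ (toℕ-injective (trans (sym k≡σx) (sym toℕk′)))

  avoiding : ∀ {n} → Fin n → List (Subset n) → List (Subset n)
  avoiding e = filter (λ S → ¬? (e ∈? S))

  length-avoiding : ∀ {n} e (seq : List (Subset n)) → length seq ≡ weight seq e + length (avoiding e seq)
  length-avoiding e []      = refl
  length-avoiding e (S ∷ L) with e ∈? S
  ... | yes _ = cong suc (length-avoiding e L)
  ... | no  _ = trans (cong suc (length-avoiding e L)) (sym (+-suc _ _))

  sum-≤-avoiding : ∀ {n} e (f : Subset n → ℕ) a seq → (∀ {S} → e ∈ S → f S ≤ a) →
                   sum (map f seq) ≤ weight seq e * a + sum (map f (avoiding e seq))
  sum-≤-avoiding e f a []      f≤a = z≤n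
  sum-≤-avoiding e f a (S ∷ L) f≤a with e ∈? S
  ... | yes e∈S = begin
    f S + sum (map f L)                                 ≤⟨ +-mono-≤ (f≤a e∈S) (sum-≤-avoiding e f a L f≤a) ⟩
    a + (weight L e * a + sum (map f (avoiding e L)))   ≡⟨ +-assoc a _ _ ⟨
    suc (weight L e) * a + sum (map f (avoiding e L))   ∎
    where open ≤-Reasoning
  ... | no  _ = begin
    f S + sum (map f L)                                 ≤⟨ +-monoʳ-≤ (f S) (sum-≤-avoiding e f a L f≤a) ⟩
    f S + (weight L e * a + sum (map f (avoiding e L))) ≡⟨ +-comm (f S) _ ⟩
    (weight L e * a + sum (map f (avoiding e L))) + f S ≡⟨ +-assoc (weight L e * a) _ (f S) ⟩
    weight L e * a + (sum (map f (avoiding e L)) + f S) ≡⟨ cong (_+_ (weight L e * a)) (+-comm _ (f S)) ⟩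
    weight L e * a + (f S + sum (map f (avoiding e L))) ∎
    where open ≤-Reasoning

  access-≤ : ∀ {n} (π : Permutation′ n) S {e} → e ∈ S → access π S ≤ pos π e
  access-≤ {n} π S {e} e∈S = go (allFin n) (∈-allFin e)
    where
    go : ∀ L → e ∈ₗ L → foldr (λ x acc → if does (x ∈? S) then pos π x ⊓ acc else acc) n L ≤ pos π e
    go (x ∷ L) (here refl) rewrite dec-true (x ∈? S) e∈S = m⊓n≤m (pos π x) _
    go (x ∷ L) (there e∈L) with does (x ∈? S)
    ... | true  = ≤-trans (m⊓n≤n (pos π x) _) (go L e∈L)
    ... | false = go L e∈L

  ≤-access : ∀ {n} (π : Permutation′ n) S {b} → b ≤ n → (∀ {e} → e ∈ S → b ≤ pos π e) →
             b ≤ access π S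
  ≤-access {n} π S {b} b≤n b≤S = go (allFin n)
    where
    go : ∀ L → b ≤ foldr (λ x acc → if does (x ∈? S) then pos π x ⊓ acc else acc) n L
    go []      = b≤n
    go (x ∷ L) with x ∈? S
    ... | yes x∈S = ⊓-glb (b≤S x∈S) (go L)
    ... | no  _   = go L

  access-cong : ∀ {n} {π σ : Permutation′ n} → π ≈ σ → ∀ S → access π S ≡ access σ S
  access-cong {n} {π} {σ} π≈σ S = go (allFin n)
    where
    go : ∀ L → foldr (λ x acc → if does (x ∈? S) then pos π x ⊓ acc else acc) n L
             ≡ foldr (λ x acc → if does (x ∈? S) then pos σ x ⊓ acc else acc) n L
    go []      = refl
    go (x ∷ L) with does (x ∈? S)
    ... | true  = cong₂ _⊓_ (cong (suc ∘ toℕ) (π≈σ x)) (go L)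
    ... | false = go L

  staticCost-cong : ∀ {n} {π σ : Permutation′ n} → π ≈ σ → ∀ seq → staticCost π seq ≡ staticCost σ seq
  staticCost-cong             π≈σ []      = refl
  staticCost-cong {π = π} {σ} π≈σ (S ∷ L) =
    cong₂ _+_ (access-cong {π = π} {σ} π≈σ S) (staticCost-cong {π = π} {σ} π≈σ L)

  tailCount-shift : ∀ {n} {σ σ′ : Permutation′ n} {k e} →
                    (∀ x → x ≢ e → inTail (suc k) σ′ x ≡ inTail k σ x) →
                    ∀ {S} → e ∉ S → tailCount (suc k) σ′ S ≡ tailCount k σ S
  tailCount-shift {n} {σ} {σ′} {k} {e} shift {S} e∉S = sum-cong-≗ {n} pointwise
    where
    pointwise : ∀ x → χ S x * inTail (suc k) σ′ x ≡ χ S x * inTail k σ x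
    pointwise x with x ≟ e
    ... | yes refl rewrite χ-∉ e∉S = refl
    ... | no  x≢e  = cong (χ S x *_) (shift x x≢e)

  ∑-weight*inTail≤ : ∀ {n} k (σ : Permutation′ n) seq W → (∀ x → k ≤ index σ x → weight seq x ≤ W) →
                     ∑[ x < n ] (weight seq x * inTail k σ x) ≤ W * (n ∸ k)
  ∑-weight*inTail≤ {n} k σ seq W heaviest = begin
    ∑[ x < n ] (weight seq x * inTail k σ x) ≤⟨ ∑-mono-≤ pointwise ⟩
    ∑[ x < n ] (W * inTail k σ x)            ≡⟨ *-distribˡ-sum W (inTail k σ) ⟨
    W * ∑[ x < n ] inTail k σ x              ≡⟨ cong (W *_) (tail-size k σ) ⟩
    W * (n ∸ k)                              ∎
    where
    open ≤-Reasoning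
    pointwise : ∀ x → weight seq x * inTail k σ x ≤ W * inTail k σ x
    pointwise x = byCases (k ≤? index σ x)
      where
      byCases : (k≤?σx : Dec (k ≤ index σ x)) → weight seq x * 𝟙 (does k≤?σx) ≤ W * 𝟙 (does k≤?σx)
      byCases (yes k≤σx) = *-monoˡ-≤ 1 (heaviest x k≤σx)
      byCases (no  _)    = ≤-reflexive (trans (*-zeroʳ (weight seq x)) (sym (*-zeroʳ W)))

  +≡⇒∸≡ : ∀ {k j n} → k + j ≡ n → n ∸ k ≡ j
  +≡⇒∸≡ {k} {j} refl = m+n∸m≡n k j

  argmax-exists : ∀ {n} {P : Pred (Fin n) 0ℓ} → Decidable P → ∀ {x₀} → P x₀ → (w : Fin n → ℕ) →
                  ∃ λ e → P e × (∀ x → P x → w x ≤ w e)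
  argmax-exists {n} {P} P? {x₀} Px₀ w = e , argmax-all w Px₀ (all-filter P? (allFin n)) , maximal
    where
    e = argmax w x₀ (filter P? (allFin n))
    maximal : ∀ x → P x → w x ≤ w e
    maximal x Px = All.lookup (f[xs]≤f[argmax] x₀ (filter P? (allFin n))) (∈-filter⁺ P? (∈-allFin x) Px)

  occupant : ∀ {n} k (σ : Permutation′ n) → k < n → ∃ λ x → index σ x ≡ k
  occupant k σ k<n = σ ⟨$⟩ˡ fromℕ< k<n , trans (cong toℕ (inverseʳ σ)) (toℕ-fromℕ< k<n)

  pigeonhole : ∀ {n} r j k (σ : Permutation′ n) → k + j ≡ n → (seq : List (Subset n)) →
               All (λ S → tailCount k σ S ≡ r) seq →
               ∀ {e} → (∀ x → k ≤ index σ x → weight seq x ≤ weight seq e) →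
               length seq * r ≤ weight seq e * j
  pigeonhole {n} r j k σ k+j≡n seq counts≡r {e} heaviest = begin
    length seq * r                           ≡⟨ sum-map-const (tailCount k σ) seq counts≡r ⟨
    sum (map (tailCount k σ) seq)            ≡⟨ double-counting (inTail k σ) seq ⟨
    ∑[ x < n ] (weight seq x * inTail k σ x) ≤⟨ ∑-weight*inTail≤ k σ seq (weight seq e) heaviest ⟩
    weight seq e * (n ∸ k)                   ≡⟨ cong (weight seq e *_) (+≡⇒∸≡ k+j≡n) ⟩
    weight seq e * j                         ∎
    where open ≤-Reasoning

  greedy-recurrence : ∀ {cost C len} c m k r j → len ≡ c + m →
                      cost ≤ c * suc k + C → C * suc r ≤ m * (suc k * suc r + j) → len * r ≤ c * j →
                      cost * suc r ≤ len * (k * suc r + suc j)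
  greedy-recurrence {cost} {C} c m k r j refl cost≤ IH avg = begin
    cost * suc r                                            ≤⟨ *-monoˡ-≤ (suc r) cost≤ ⟩
    (c * suc k + C) * suc r                                 ≡⟨ *-distribʳ-+ (suc r) (c * suc k) C ⟩
    c * suc k * suc r + C * suc r                           ≤⟨ +-monoʳ-≤ (c * suc k * suc r) IH ⟩
    c * suc k * suc r + m * (suc k * suc r + j)             ≡⟨ expand c m k r j ⟩
    (c + m) * (k * suc r) + (c + m) + ((c + m) * r + m * j)
      ≤⟨ +-monoʳ-≤ ((c + m) * (k * suc r) + (c + m)) (+-monoˡ-≤ (m * j) avg) ⟩
    (c + m) * (k * suc r) + (c + m) + (c * j + m * j)       ≡⟨ collect c m k r j ⟩
    (c + m) * (k * suc r + suc j)                           ∎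
    where
    open ≤-Reasoning
    expand : ∀ c m k r j → c * suc k * suc r + m * (suc k * suc r + j) ≡
                           (c + m) * (k * suc r) + (c + m) + ((c + m) * r + m * j)
    expand = solve 5 (λ c m k r j → c :* (con 1 :+ k) :* (con 1 :+ r) :+ m :* ((con 1 :+ k) :* (con 1 :+ r) :+ j) :=
                                    (c :+ m) :* (k :* (con 1 :+ r)) :+ (c :+ m) :+ ((c :+ m) :* r :+ m :* j)) refl
    collect : ∀ c m k r j → (c + m) * (k * suc r) + (c + m) + (c * j + m * j) ≡ (c + m) * (k * suc r + suc j)
    collect = solve 5 (λ c m k r j → (c :+ m) :* (k :* (con 1 :+ r)) :+ (c :+ m) :+ (c :* j :+ m :* j) :=
                                     (c :+ m) :* (k :* (con 1 :+ r) :+ (con 1 :+ j))) refl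

  -- The bound says that a request costs on average at most k + (j + 1)/(r + 1).
  greedy : ∀ {n} r → 1 ≤ r → ∀ j k (σ : Permutation′ n) → k + j ≡ n → (seq : List (Subset n)) →
           All (λ S → tailCount k σ S ≡ r) seq →
           ∃ λ τ → AgreeBelow k σ τ × staticCost τ seq * suc r ≤ length seq * (k * suc r + suc j)
  greedy r 1≤r j k σ k+j≡n [] _ = σ , (λ _ _ → refl) , z≤n
  greedy {n} r 1≤r zero k σ k+0≡n (S ∷ _) (count≡r ∷ _) = ⊥-elim (<⇒≱ 1≤r (begin
    r               ≡⟨ count≡r ⟨
    tailCount k σ S ≤⟨ tailCount≤ k σ S ⟩
    n ∸ k           ≡⟨ +≡⇒∸≡ k+0≡n ⟩
    0               ∎))
    where open ≤-Reasoning
  greedy {n} r 1≤r (suc j) k σ k+j≡n seq@(_ ∷ _) counts≡r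
    with occupant k σ (subst (k <_) k+j≡n (m<m+n k z<s))
  ... | x₀ , σx₀≡k with argmax-exists (λ x → k ≤? index σ x) (≤-reflexive (sym σx₀≡k)) (weight seq)
  ... | e , k≤e , heaviest = τ , agreeτ , bound
    where
    open Moved (moveTo σ k e k≤e)
    rest = greedy r 1≤r j (suc k) σ′ (trans (sym (+-suc k j)) k+j≡n) (avoiding e seq)
             (All.zipWith (λ (e∉S , count≡r) → trans (tailCount-shift {σ = σ} {σ′} {k} shift e∉S) count≡r)
                          (all-filter (λ S → ¬? (e ∈? S)) seq , filter⁺ (λ S → ¬? (e ∈? S)) counts≡r))
    τ = proj₁ rest
    agreeτ : AgreeBelow k σ τ
    agreeτ x σx<k = trans (proj₁ (proj₂ rest) x σ′x<suc-k) (agree x σx<k)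
      where
      σ′x<suc-k : index σ′ x < suc k
      σ′x<suc-k = subst (_< suc k) (sym (cong toℕ (agree x σx<k))) (m<n⇒m<1+n σx<k)
    τ-e : pos τ e ≡ suc k
    τ-e = cong suc (trans (cong toℕ (proj₁ (proj₂ rest) e (≤-reflexive (cong suc placed)))) placed)
    bound : staticCost τ seq * suc r ≤ length seq * (k * suc r + suc (suc j))
    bound = greedy-recurrence (weight seq e) (length (avoiding e seq)) k r (suc j) (length-avoiding e seq)
      (sum-≤-avoiding e (access τ) (suc k) seq (λ {S} e∈S → subst (access τ S ≤_) τ-e (access-≤ τ S e∈S)))
      (proj₂ (proj₂ rest))
      (pigeonhole r (suc j) k σ k+j≡n seq counts≡r {e} heaviest)

  tailCount-id : ∀ {n} (S : Subset n) → tailCount 0 id S ≡ ∣ S ∣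
  tailCount-id {n} S = trans (sum-cong-≗ {n} (λ x → *-identityʳ (χ S x))) (sym (∣S∣≡∑χ S))

  OPT-upper-bound : ∀ {n} r → 1 ≤ r → (seq : List (Subset n)) → All (λ S → ∣ S ∣ ≡ r) seq →
                    ∀ {o} → IsOPT seq o → o * suc r ≤ length seq * suc n
  OPT-upper-bound {n} r 1≤r seq sizes (_ , minimal)
    with greedy r 1≤r n 0 id refl seq (All.map (λ {S} |S|≡r → trans (tailCount-id S) |S|≡r) sizes)
  ... | τ , _ , bound = ≤-trans (*-monoˡ-≤ (suc r) (minimal τ)) bound

  -- OPT is attained

  permutations : ∀ n → List (Permutation′ n)
  permutations zero    = [ id ]
  permutations (suc n) = cartesianProductWith (insert zero) (allFin (suc n)) (permutations n)

  insert-cong : ∀ {n} j {π ρ : Permutation′ n} → π ≈ ρ → insert zero j π ≈ insert zero j ρ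
  insert-cong j         π≈ρ zero    = refl
  insert-cong j {π} {ρ} π≈ρ (suc x) = begin
    insert zero j π ⟨$⟩ʳ suc x ≡⟨ insert-punchIn zero j π x ⟩
    punchIn j (π ⟨$⟩ʳ x)       ≡⟨ cong (punchIn j) (π≈ρ x) ⟩
    punchIn j (ρ ⟨$⟩ʳ x)       ≡⟨ insert-punchIn zero j ρ x ⟨
    insert zero j ρ ⟨$⟩ʳ suc x ∎
    where open ≡-Reasoning

  ∈-permutations : ∀ {n} (σ : Permutation′ n) → ∃ λ τ → τ ∈ₗ permutations n × τ ≈ σ
  ∈-permutations {zero}  σ = id , here refl , λ ()
  ∈-permutations {suc n} σ with ∈-permutations (remove zero σ)
  ... | τ , τ∈ , τ≈σ = insert zero (σ ⟨$⟩ʳ zero) τ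
                     , ∈-cartesianProductWith⁺ (insert zero) (∈-allFin (σ ⟨$⟩ʳ zero)) τ∈
                     , λ x → trans (insert-cong (σ ⟨$⟩ʳ zero) τ≈σ x) (insert-remove zero σ x)

  optimum : ∀ {n} (seq : List (Subset n)) → ∃ (IsOPT seq)
  optimum {n} seq = staticCost σ* seq , (σ* , refl) , minimal
    where
    σ* = argmin (λ σ → staticCost σ seq) id (permutations n)
    minimal : ∀ σ → staticCost σ* seq ≤ staticCost σ seq
    minimal σ with ∈-permutations σ
    ... | τ , τ∈ , τ≈σ = ≤-trans (All.lookup (f[argmin]≤f[xs] id (permutations n)) τ∈)
                                 (≤-reflexive (staticCost-cong {π = τ} {σ} τ≈σ seq))

  -- The adversary

  lastPositions : ∀ {n} → ℕ → Permutation′ n → Subset n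
  lastPositions {n} r π = tabulate (λ x → does (n ∸ r ≤? index π x))

  does-∈?≡lookup : ∀ {n} (S : Subset n) x → does (x ∈? S) ≡ lookup S x
  does-∈?≡lookup (true  ∷ S) zero    = refl
  does-∈?≡lookup (false ∷ S) zero    = refl
  does-∈?≡lookup (_     ∷ S) (suc x) = does-∈?≡lookup S x

  ∣lastPositions∣ : ∀ {n} r (π : Permutation′ n) → r ≤ n → ∣ lastPositions r π ∣ ≡ r
  ∣lastPositions∣ {n} r π r≤n = begin
    ∣ lastPositions r π ∣              ≡⟨ ∣S∣≡∑χ (lastPositions r π) ⟩
    ∑[ x < n ] χ (lastPositions r π) x
      ≡⟨ sum-cong-≗ {n} (λ x → cong 𝟙 (trans (does-∈?≡lookup _ x) (lookup∘tabulate _ x))) ⟩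
    ∑[ x < n ] inTail (n ∸ r) π x      ≡⟨ tail-size (n ∸ r) π ⟩
    n ∸ (n ∸ r)                        ≡⟨ m∸[m∸n]≡n r≤n ⟩
    r                                  ∎
    where open ≡-Reasoning

  access-lastPositions : ∀ {n} r (π : Permutation′ n) → 1 ≤ r → r ≤ n →
                         suc n ∸ r ≤ access π (lastPositions r π)
  access-lastPositions {n} r π 1≤r r≤n rewrite +-∸-assoc 1 r≤n =
    ≤-access π (lastPositions r π) (∸-monoʳ-< 1≤r r≤n) (λ {e} e∈S → s≤s (late e e∈S))
    where
    late : ∀ e → e ∈ lastPositions r π → n ∸ r ≤ index π e
    -- does (m ≤? n) computes to m ≤ᵇ n.
    late e e∈S = ≤ᵇ⇒≤ (n ∸ r) (index π e)
      (subst T (trans (sym ([]=⇒lookup e∈S)) (lookup∘tabulate _ e)) tt)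

  adversary : ∀ {n} → ℕ → OnlineAlg n → Permutation′ n → Permutation′ n → List (Subset n) → ℕ →
              List (Subset n)
  adversary r A π₀ cur past zero    = []
  adversary r A π₀ cur past (suc m) = S ∷ adversary r A π₀ (A π₀ (past ++ [ S ])) (past ++ [ S ]) m
    where S = lastPositions r cur

  length-adversary : ∀ {n} r A (π₀ cur : Permutation′ n) past m → length (adversary r A π₀ cur past m) ≡ m
  length-adversary r A π₀ cur past zero    = refl
  length-adversary r A π₀ cur past (suc m) = cong suc (length-adversary r A π₀ _ _ m)

  ∣adversary∣ : ∀ {n} r A (π₀ cur : Permutation′ n) past m → r ≤ n →
                All (λ S → ∣ S ∣ ≡ r) (adversary r A π₀ cur past m)
  ∣adversary∣ r A π₀ cur past zero    r≤n = []
  ∣adversary∣ r A π₀ cur past (suc m) r≤n = ∣lastPositions∣ r cur r≤n ∷ ∣adversary∣ r A π₀ _ _ m r≤n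

  run-adversary : ∀ {n} r A (π₀ cur : Permutation′ n) past m → 1 ≤ r → r ≤ n →
                  m * (suc n ∸ r) ≤ run A π₀ cur past (adversary r A π₀ cur past m)
  run-adversary r A π₀ cur past zero    1≤r r≤n = z≤n
  run-adversary r A π₀ cur past (suc m) 1≤r r≤n =
    +-mono-≤ (≤-trans (access-lastPositions r cur 1≤r r≤n) (m≤m+n _ _)) (run-adversary r A π₀ _ _ m 1≤r r≤n)

  -- Clearing denominators

  ℕ-beats : ∀ p N D s q o m α alg → p * N < q * s * D → o * q ≤ m * N → m * s ≤ alg →
            q * α * D < m → p * o + α * D < alg * D
  ℕ-beats p N D s q o m α alg pN<qsD oq≤mN ms≤alg margin = *-cancelˡ-< q (p * o + α * D) (alg * D) (begin-strict
    q * (p * o + α * D)      ≡⟨ regroup p o q α D ⟩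
    p * (o * q) + q * α * D  ≤⟨ +-monoˡ-≤ (q * α * D) (*-monoʳ-≤ p oq≤mN) ⟩
    p * (m * N) + q * α * D  <⟨ +-monoʳ-< (p * (m * N)) margin ⟩
    p * (m * N) + m          ≡⟨ factor p m N ⟩
    m * suc (p * N)          ≤⟨ *-monoʳ-≤ m pN<qsD ⟩
    m * (q * s * D)          ≡⟨ reorder m q s D ⟩
    q * (m * s * D)          ≤⟨ *-monoʳ-≤ q (*-monoˡ-≤ D ms≤alg) ⟩
    q * (alg * D)            ∎)
    where
    open ≤-Reasoning
    regroup : ∀ p o q α D → q * (p * o + α * D) ≡ p * (o * q) + q * α * D
    regroup = solve 5 (λ p o q α D → q :* (p :* o :+ α :* D) := p :* (o :* q) :+ q :* α :* D) refl
    factor : ∀ p m N → p * (m * N) + m ≡ m * suc (p * N)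
    factor = solve 3 (λ p m N → p :* (m :* N) :+ m := m :* (con 1 :+ p :* N)) refl
    reorder : ∀ m q s D → m * (q * s * D) ≡ q * (m * s * D)
    reorder = solve 4 (λ m q s D → m :* (q :* s :* D) := q :* (m :* s :* D)) refl

  ℤ-beats : ∀ a N d s q o m α alg → a ℤ.* + N ℤ.< + (q * s) ℤ.* + suc d →
            o * q ≤ m * N → m * s ≤ alg → q * α * suc d < m → α < alg →
            a ℤ.* + o ℤ.+ + α ℤ.* + suc d ℤ.< + alg ℤ.* + suc d
  ℤ-beats (+ p) N d s q o m α alg aN<qsD oq≤mN ms≤alg margin _ =
    subst₂ ℤ._<_ lhs (ℤ.pos-* alg (suc d)) (ℤ.+<+ (ℕ-beats p N (suc d) s q o m α alg pN<qsD oq≤mN ms≤alg margin))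
    where
    lhs : + (p * o + α * suc d) ≡ + p ℤ.* + o ℤ.+ + α ℤ.* + suc d
    lhs = trans (ℤ.pos-+ (p * o) (α * suc d)) (cong₂ ℤ._+_ (ℤ.pos-* p o) (ℤ.pos-* α (suc d)))
    pN<qsD : p * N < q * s * suc d
    pN<qsD = ℤ.drop‿+<+ (subst₂ ℤ._<_ (sym (ℤ.pos-* p N)) (sym (ℤ.pos-* (q * s) (suc d))) aN<qsD)
  ℤ-beats -[1+ p ] N d s q o m α alg _ _ _ _ α<alg = begin-strict
    -[1+ p ] ℤ.* + o ℤ.+ + α ℤ.* + suc d ≤⟨ ℤ.+-monoˡ-≤ (+ α ℤ.* + suc d) (ℤ.*-monoʳ-≤-nonNeg (+ o) (ℤ.-≤+ {p} {0})) ⟩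
    + 0 ℤ.+ + α ℤ.* + suc d              ≡⟨ ℤ.+-identityˡ (+ α ℤ.* + suc d) ⟩
    + α ℤ.* + suc d                      <⟨ ℤ.*-monoʳ-<-pos (+ suc d) (ℤ.+<+ α<alg) ⟩
    + alg ℤ.* + suc d                    ∎
    where open ℤ.≤-Reasoning

  <-/suc⇒cross : ∀ (c : ℚ) K N → c ℚ.< + K / suc N → ↥ c ℤ.* + suc N ℤ.< + K ℤ.* + ↧ₙ c
  <-/suc⇒cross c@record{} K N c<K/N
    with ℚᵘ.<-respʳ-≃ (toℚᵘ-fromℚᵘ (mkℚᵘ (+ K) N)) (toℚᵘ-mono-< c<K/N)
  ... | *<* cross = cross

  cross⇒<-/1 : ∀ (c : ℚ) o α alg → ↥ c ℤ.* + o ℤ.+ + α ℤ.* + ↧ₙ c ℤ.< + alg ℤ.* + ↧ₙ c →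
            c ℚ.* (+ o / 1) ℚ.+ (+ α / 1) ℚ.< + alg / 1
  cross⇒<-/1 c@(mkℚ a d _) o α alg cross = toℚᵘ-cancel-<
    (ℚᵘ.<-respˡ-≃ (ℚᵘ.≃-sym unnormalised)
      (ℚᵘ.<-respʳ-≃ (ℚᵘ.≃-sym (toℚᵘ-fromℚᵘ (mkℚᵘ (+ alg) 0))) (*<* (subst₂ ℤ._<_ lhs rhs cross))))
    where
    c·o+α = mkℚᵘ a d ℚᵘ.* mkℚᵘ (+ o) 0 ℚᵘ.+ mkℚᵘ (+ α) 0
    unnormalised : toℚᵘ (c ℚ.* (+ o / 1) ℚ.+ (+ α / 1)) ℚᵘ.≃ c·o+α
    unnormalised = ℚᵘ.≃-trans (toℚᵘ-homo-+ (c ℚ.* (+ o / 1)) (+ α / 1))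
      (ℚᵘ.+-cong (ℚᵘ.≃-trans (toℚᵘ-homo-* c (+ o / 1))
                              (ℚᵘ.*-cong (ℚᵘ.≃-refl {mkℚᵘ a d}) (toℚᵘ-fromℚᵘ (mkℚᵘ (+ o) 0))))
                 (toℚᵘ-fromℚᵘ (mkℚᵘ (+ α) 0)))
    lhs : a ℤ.* + o ℤ.+ + α ℤ.* + suc d ≡ ℚᵘ.↥ c·o+α ℤ.* + 1
    lhs = sym (trans (ℤ.*-identityʳ _)
                     (cong₂ ℤ._+_ (ℤ.*-identityʳ (a ℤ.* + o)) (cong (λ z → + α ℤ.* + suc z) (*-identityʳ d))))
    rhs : + alg ℤ.* + suc d ≡ + alg ℤ.* ℚᵘ.↧ c·o+α
    rhs = cong (λ z → + alg ℤ.* + suc z) (sym (trans (*-identityʳ (d * 1)) (*-identityʳ d)))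

  rounds-to-beat : ∀ (c : ℚ) q s N α → 1 ≤ s → c ℚ.< + (q * s) / suc N →
                   ∃ λ m → ∀ o alg → o * q ≤ m * suc N → m * s ≤ alg →
                           c ℚ.* (+ o / 1) ℚ.+ (+ α / 1) ℚ.< + alg / 1
  rounds-to-beat c q s N α 1≤s c<qs/N = m , beats
    where
    -- Multiplying a·(N + 1) < q·s·D by m gains a slack of m, which must exceed q·α·D;
    -- α < m ≤ alg settles the case a < 0.
    m = suc (q * α * ↧ₙ c + α)
    beats : ∀ o alg → o * q ≤ m * suc N → m * s ≤ alg → c ℚ.* (+ o / 1) ℚ.+ (+ α / 1) ℚ.< + alg / 1
    beats o alg oq≤mN ms≤alg = cross⇒<-/1 c o α alg
      (ℤ-beats (↥ c) (suc N) (ℚ.denominator-1 c) s q o m α alg (<-/suc⇒cross c (q * s) N c<qs/N) oq≤mN ms≤alg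
               (s≤s (m≤m+n (q * α * ↧ₙ c) α))
               (<-≤-trans (s≤s (m≤n+m α (q * α * ↧ₙ c))) (≤-trans (m≤m*n m s {{>-nonZero 1≤s}}) ms≤alg)))

  OPT-adversary : ∀ {n} r A (π₀ : Permutation′ n) m → 1 ≤ r → r ≤ n →
                  ∀ {o} → IsOPT (adversary r A π₀ π₀ [] m) o → o * (r + 1) ≤ m * suc n
  OPT-adversary {n} r A π₀ m 1≤r r≤n {o} isOPT =
    subst₂ (λ q len → o * q ≤ len * suc n) (+-comm 1 r) (length-adversary r A π₀ π₀ [] m)
           (OPT-upper-bound r 1≤r (adversary r A π₀ π₀ [] m) (∣adversary∣ r A π₀ π₀ [] m r≤n) isOPT)


open import Defs
open import Data.Nat using (ℕ; suc; _+_; _*_; _∸_; _≤_; s≤s)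
open import Data.Nat.Properties using (m<n⇒0<n∸m)
open import Data.Integer using (+_)
open import Data.Rational using (ℚ; _/_; _<_)
open import Data.Fin.Permutation using (Permutation′; id)
open import Data.Fin.Subset using (Subset; ∣_∣)
open import Data.List using (List; [])
open import Data.List.Relation.Unary.All using (All)
open import Data.Product using (Σ; _×_; _,_; proj₁; proj₂)
open import Relation.Binary.PropositionalEquality using (_≡_)
open LowerBound using (rounds-to-beat; adversary; ∣adversary∣; run-adversary; optimum; OPT-adversary)

theorem1 : (n r : ℕ) → 1 ≤ n → 1 ≤ r → r ≤ n →
  (A : OnlineAlg n) →
  (c : ℚ) → c < (+ ((r + 1) * (suc n ∸ r))) / (suc n) →
  (α : ℕ) →
  Σ (Permutation′ n) (λ π₀ →
    Σ (List (Subset n)) (λ seq →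
      All (λ S → ∣ S ∣ ≡ r) seq ×
      Σ ℕ (λ o → IsOPT seq o ×
        (c Data.Rational.* ((+ o) / 1) Data.Rational.+ ((+ α) / 1) < (+ algCost A π₀ seq) / 1))))
theorem1 n r _ 1≤r r≤n A c c<bound α =
  id , requests , ∣adversary∣ r A id id [] m r≤n , OPT , isOPT ,
  beats OPT (algCost A id requests) (OPT-adversary r A id m 1≤r r≤n isOPT) (run-adversary r A id id [] m 1≤r r≤n)
  where
  rounds = rounds-to-beat c (r + 1) (suc n ∸ r) n α (m<n⇒0<n∸m (s≤s r≤n)) c<bound
  m = proj₁ rounds
  beats = proj₂ rounds
  requests = adversary r A id id [] m
  OPT = proj₁ (optimum requests)
  isOPT = proj₂ (optimum requests)
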